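{- Let $k\ge 1$. An inversion sequence is sortable by a pop stack of depth $k$ if and only if it avoids each of the patterns $120$, $201$, $1010$, and $k(k-1)\cdots 10$ (the strictly decreasing pattern of length $k+1$).
   Context: An inversion sequence of length $n$ is a word $e=e_1\cdots e_n$ of integers with $0\le e_i\le i-1$. A word $w=w_1\cdots w_n$ contains a pattern $p=p_1\cdots p_m$ if there are indices $\alpha_1<\cdots<\alpha_m$ with $w_{\alpha_i}<w_{\alpha_j}$ iff $p_i<p_j$ and $w_{\alpha_i}=w_{\alpha_j}$ iff $p_i=p_j$; otherwise $w$ avoids $p$. A pop stack is a stack (entries read left to right; a push moves the next input entry onto the top of the stack) in which every pop operation empties the whole stack, moving all its entries to the end of the output from top to bottom. A pop stack of depth $k$ is a pop stack whose contents may, at every stage, contain entries of at most $k$ distinct values. A word is sortable by such a device if some admissible sequence of pushes and pops outputs all its entries in weakly increasing order. -}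

module Defs where

open import Data.Nat using (ℕ; zero; suc; _<_; _≤_; _≟_)
open import Data.Nat.Properties using ()
open import Data.Fin using (Fin; cast)
open import Data.List using (List; []; _∷_; _++_; length; lookup; deduplicate)
open import Data.List.Relation.Binary.Sublist.Propositional using (_⊆_)
open import Data.List.Relation.Unary.Linked using (Linked)
open import Data.Product using (Σ; ∃; _×_)
open import Data.Unit using (⊤)
open import Function.Bundles using (_⇔_)
open import Relation.Binary.PropositionalEquality using (_≡_)
open import Relation.Nullary using (¬_)

-- Inversion sequence e₁⋯eₙ with 0 ≤ eᵢ ≤ i-1.
-- InvSeqFrom m w : the entries of w sit at positions m+1, m+2, …,
-- so the entry at position i = m+1 must satisfy e < i.
InvSeqFrom : ℕ → List ℕ → Set
InvSeqFrom m []       = ⊤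
InvSeqFrom m (x ∷ xs) = (x < suc m) × InvSeqFrom (suc m) xs

IsInversionSequence : List ℕ → Set
IsInversionSequence = InvSeqFrom 0

OrderIsomorphic : List ℕ → List ℕ → Set
OrderIsomorphic s p =
  Σ (length s ≡ length p) λ eq →
    ∀ (i j : Fin (length s)) →
      ((lookup s i < lookup s j) ⇔ (lookup p (cast eq i) < lookup p (cast eq j)))
      × ((lookup s i ≡ lookup s j) ⇔ (lookup p (cast eq i) ≡ lookup p (cast eq j)))

Contains : List ℕ → List ℕ → Set
Contains w p = ∃ λ s → (s ⊆ w) × OrderIsomorphic s p

Avoids : List ℕ → List ℕ → Set
Avoids w p = ¬ Contains w p

distinctCount : List ℕ → ℕ
distinctCount xs = length (deduplicate _≟_ xs)

-- PopRun k input stack out : starting with remaining input `input` and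
-- stack contents `stack` (top of stack first), an admissible sequence of
-- pushes and pops of a pop stack of depth k empties both and appends `out`
-- to the output.
data PopRun (k : ℕ) : List ℕ → List ℕ → List ℕ → Set where
  done : PopRun k [] [] []
  push : ∀ {x xs st out} → distinctCount (x ∷ st) ≤ k →
         PopRun k xs (x ∷ st) out → PopRun k (x ∷ xs) st out
  pop  : ∀ {xs st out} → PopRun k xs [] out → PopRun k xs st (st ++ out)

PopSortable : ℕ → List ℕ → Set
PopSortable k w = ∃ λ out → PopRun k w [] out × Linked _≤_ out

-- A pop stack sorts a word only if every pop empties a stack that is weakly increasing from the top
-- and holds nothing larger than an entry still unread. No run on the words 120, 201 or 1010 meets
-- this, and a sorting run on a strictly decreasing word must stack it in full, which takes k+1
-- distinct values; since sortability passes to subsequences, sortable words avoid all four patterns.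
-- Conversely, the greedy strategy (push while the next entry is at most the top, otherwise pop first)
-- sorts every word avoiding them: a depth overflow exhibits k+1 distinct stacked values, hence a
-- decreasing subsequence of length k+1, and a stacked entry exceeding an unread one exhibits 120, 201
-- or 1010 in the stack read bottom-up followed by the unread input.
module Submission where

open import Defs
open import Data.Nat using (ℕ; suc; _+_; _≤_; _<_; _>_; _≟_; _≤?_; z<s; s<s)
open import Data.Nat.Properties
  using (≤-refl; <-trans; <-cmp; <-asym; <⇒≢; <⇒≤; <⇒≱; ≰⇒>; ≮⇒≥; ≤-trans; n≮n; +-suc; +-comm;
         m≤n⇒m<n∨m≡n; m≤n⇒m⊓n≡m; suc-injective)
open import Data.List using (List; _∷_; []; downFrom; _++_; length; lookup; zip; take; reverse; _ʳ++_)
open import Data.List.Properties using (length-downFrom; length-reverse; length-take; length-deduplicate)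
open import Data.List.Membership.Propositional using (_∈_)
open import Data.List.Membership.Propositional.Properties
  using (∈-++⁺ˡ; ∈-++⁺ʳ; ∈-++⁻; ∈-deduplicate⁺; ∈-deduplicate⁻)
open import Data.List.Relation.Unary.Any using (here; there)
open import Data.List.Relation.Unary.All as All using (All; []; _∷_)
open import Data.List.Relation.Unary.AllPairs as AllPairs using (AllPairs; []; _∷_)
import Data.List.Relation.Unary.AllPairs.Properties as AllPairs
open import Data.List.Relation.Unary.Linked as Linked using (Linked; []; [-]; _∷_)
open import Data.List.Relation.Unary.Linked.Properties
  using (Linked⇒AllPairs; AllPairs⇒Linked; applyDownFrom⁺₂)
open import Data.List.Relation.Unary.Unique.Propositional using (Unique)
open import Data.List.Relation.Unary.Unique.DecPropositional.Properties _≟_ using (deduplicate-!)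
open import Data.List.Relation.Binary.Sublist.Propositional
  using (_⊆_; []; _∷_; _∷ʳ_; ⊆-refl; ⊆-trans; minimum; from∈)
open import Data.List.Relation.Binary.Sublist.Propositional.Properties
  using (All-resp-⊆; Any-resp-⊆; ++⁺; ++⁺ʳ; ʳ++⁺; take-⊆)
import Data.List.Fresh as Fresh
open import Data.List.Fresh.Relation.Unary.Any using () renaming (here to here#; there to there#)
open import Data.Product using (∃; _×_; _,_; proj₁; proj₂)
open import Data.Sum using (_⊎_; inj₁; inj₂; [_,_]′)
open import Data.Empty using (⊥-elim)
open import Data.Fin using (zero; suc; cast)
open import Function using (_∘_; flip; _on_; id)
open import Function.Bundles using (_⇔_; mk⇔; Equivalence)
import Function.Properties.Equivalence as ⇔
open import Relation.Binary using (Rel; Transitive; tri<; tri≈; tri>)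
open import Relation.Binary.Construct.Intersection using (_∩_)
open import Relation.Binary.PropositionalEquality using (_≡_; refl; sym; trans; cong; subst; subst₂; setoid)
open import Relation.Nullary using (¬_; contradiction; yes; no)

private variable
  k a b c t x y z : ℕ
  s p w xs ys st st′ out : List ℕ

module _ {ℓ r} {A : Set ℓ} {R : Rel A r} where

  AllPairs-resp-⊆ : {us vs : List A} → us ⊆ vs → AllPairs R vs → AllPairs R us
  AllPairs-resp-⊆ []             []          = []
  AllPairs-resp-⊆ (_ ∷ʳ us⊆vs)   (_ ∷ Rvs)   = AllPairs-resp-⊆ us⊆vs Rvs
  AllPairs-resp-⊆ (refl ∷ us⊆vs) (Rv ∷ Rvs)  = All-resp-⊆ us⊆vs Rv ∷ AllPairs-resp-⊆ us⊆vs Rvs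

  AllPairs-++-across : ∀ (us : List A) {vs u v} → AllPairs R (us ++ vs) → u ∈ us → v ∈ vs → R u v
  AllPairs-++-across (_ ∷ us) (Ru ∷ _)   (here refl) v∈vs = All.lookup Ru (∈-++⁺ʳ us v∈vs)
  AllPairs-++-across (_ ∷ us) (_ ∷ Rusvs) (there u∈us) v∈vs = AllPairs-++-across us Rusvs u∈us v∈vs

  Linked-reverse : {us : List A} → Linked R us → Linked (flip R) (reverse us)
  Linked-reverse {[]}    _ = []
  Linked-reverse {_ ∷ _} L = go L [-]
    where
    go : ∀ {u us acc} → Linked R (u ∷ us) → Linked (flip R) (u ∷ acc) → Linked (flip R) ((u ∷ us) ʳ++ acc)
    go [-]       A = A
    go (Ruv ∷ L) A = go L (Ruv ∷ A)

  module _ (R-trans : Transitive R) where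

    Linked-resp-⊆ : {us vs : List A} → us ⊆ vs → Linked R vs → Linked R us
    Linked-resp-⊆ us⊆vs = AllPairs⇒Linked ∘ AllPairs-resp-⊆ us⊆vs ∘ Linked⇒AllPairs R-trans

    Linked-++ : {us vs : List A} → Linked R us → Linked R vs → (∀ {u v} → u ∈ us → v ∈ vs → R u v) →
                Linked R (us ++ vs)
    Linked-++ Lus Lvs across = AllPairs⇒Linked
      (AllPairs.++⁺ (Linked⇒AllPairs R-trans Lus) (Linked⇒AllPairs R-trans Lvs)
                    (All.tabulate λ u∈us → All.tabulate λ v∈vs → across u∈us v∈vs))

    Linked-++-across : ∀ (us : List A) {vs u v} → Linked R (us ++ vs) → u ∈ us → v ∈ vs → R u v
    Linked-++-across us = AllPairs-++-across us ∘ Linked⇒AllPairs R-trans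

module _ {ℓ₁ ℓ₂ r₁ r₂} {A : Set ℓ₁} {B : Set ℓ₂} {R : Rel A r₁} {S : Rel B r₂} where

  Linked-zip : ∀ {us vs} → Linked R us → Linked S vs → Linked ((R on proj₁) ∩ (S on proj₂)) (zip us vs)
  Linked-zip []          _           = []
  Linked-zip {_ ∷ _} _   []          = []
  Linked-zip [-]         [-]         = [-]
  Linked-zip [-]         (_ ∷ _)     = [-]
  Linked-zip (_ ∷ _)     [-]         = [-]
  Linked-zip (Ru ∷ Lus)  (Sv ∷ Lvs)  = (Ru , Sv) ∷ Linked-zip Lus Lvs

module _ {ℓ} {A : Set ℓ} where

  open import Data.List.Fresh.Membership.Setoid (setoid A) using () renaming (_∈_ to _∈#_)
  open import Data.List.Fresh.Membership.Setoid.Properties (setoid A) using (injection)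

  private
    length-fromList : ∀ {us : List A} (U : Unique us) → Fresh.length (Fresh.fromList U) ≡ length us
    length-fromList []      = refl
    length-fromList (_ ∷ U) = cong suc (length-fromList U)

    ∈-fromList⁺ : ∀ {u} {us : List A} (U : Unique us) → u ∈ us → u ∈# Fresh.fromList U
    ∈-fromList⁺ (_ ∷ U) (here refl) = here# refl
    ∈-fromList⁺ (_ ∷ U) (there u∈us) = there# (∈-fromList⁺ U u∈us)

    ∈-fromList⁻ : ∀ {u} {us : List A} (U : Unique us) → u ∈# Fresh.fromList U → u ∈ us
    ∈-fromList⁻ (_ ∷ U) (here# refl) = here refl
    ∈-fromList⁻ (_ ∷ U) (there# u∈U) = there (∈-fromList⁻ U u∈U)

  pigeonhole : ∀ {us vs : List A} → Unique us → Unique vs → (∀ {u} → u ∈ us → u ∈ vs) → length us ≤ length vs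
  pigeonhole Uus Uvs us⊆vs = subst₂ _≤_ (length-fromList Uus) (length-fromList Uvs)
    (injection id (∈-fromList⁺ Uvs ∘ us⊆vs ∘ ∈-fromList⁻ Uus))

distinctCount-mono : (∀ {x} → x ∈ xs → x ∈ ys) → distinctCount xs ≤ distinctCount ys
distinctCount-mono {xs} {ys} xs⊆ys =
  pigeonhole (deduplicate-! xs) (deduplicate-! ys) (∈-deduplicate⁺ _≟_ ∘ xs⊆ys ∘ ∈-deduplicate⁻ _≟_ xs)

distinctCount≤length : ∀ xs → distinctCount xs ≤ length xs
distinctCount≤length = length-deduplicate _≟_

length≤distinctCount : Unique xs → length xs ≤ distinctCount xs
length≤distinctCount {xs} U = pigeonhole U (deduplicate-! xs) (∈-deduplicate⁺ _≟_)

increasing⇒unique : Linked _<_ xs → Unique xs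
increasing⇒unique = AllPairs.map <⇒≢ ∘ Linked⇒AllPairs <-trans

Concordant : Rel (ℕ × ℕ) _
Concordant (a , x) (b , y) = (a < b ⇔ x < y) × (a ≡ b ⇔ x ≡ y)

concordant-refl : Concordant (a , x) (a , x)
concordant-refl = mk⇔ (⊥-elim ∘ n≮n _) (⊥-elim ∘ n≮n _) , mk⇔ (λ _ → refl) (λ _ → refl)

concordant-sym : Concordant (a , x) (b , y) → Concordant (b , y) (a , x)
concordant-sym (<⇔ , ≡⇔) =
  mk⇔ (reflect <⇔ ≡⇔) (reflect (⇔.sym <⇔) (⇔.sym ≡⇔)) , mk⇔ (sym ∘ to ≡⇔ ∘ sym) (sym ∘ from ≡⇔ ∘ sym)
  where
  open Equivalence
  reflect : (a < b ⇔ x < y) → (a ≡ b ⇔ x ≡ y) → b < a → y < x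
  reflect {x = x} {y} <⇔ ≡⇔ b<a with <-cmp x y
  ... | tri< x<y _ _ = contradiction (from <⇔ x<y) (<-asym b<a)
  ... | tri≈ _ x≡y _ = contradiction (sym (from ≡⇔ x≡y)) (<⇒≢ b<a)
  ... | tri> _ _ y<x = y<x

concordant-< : a < b → x < y → Concordant (a , x) (b , y)
concordant-< a<b x<y = mk⇔ (λ _ → x<y) (λ _ → a<b) , mk⇔ (⊥-elim ∘ <⇒≢ a<b) (⊥-elim ∘ <⇒≢ x<y)

concordant-> : b < a → y < x → Concordant (a , x) (b , y)
concordant-> b<a y<x = concordant-sym (concordant-< b<a y<x)

concordant⇒< : Concordant (a , x) (b , y) → x < y → a < b
concordant⇒< = Equivalence.from ∘ proj₁

concordant⇒> : Concordant (a , x) (b , y) → y < x → b < a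
concordant⇒> = concordant⇒< ∘ concordant-sym

concordant⇒≡ : Concordant (a , x) (b , y) → x ≡ y → a ≡ b
concordant⇒≡ = Equivalence.from ∘ proj₂

module _ {ℓ} {P : ℕ × ℕ → Set ℓ} where

  All-zip-lookup : (eq : length s ≡ length p) → All P (zip s p) → ∀ i → P (lookup s i , lookup p (cast eq i))
  All-zip-lookup {_ ∷ _} {_ ∷ _} _  (Pu ∷ _)   zero    = Pu
  All-zip-lookup {_ ∷ _} {_ ∷ _} eq (_ ∷ Pus) (suc i) = All-zip-lookup (suc-injective eq) Pus i

  All-zip-tabulate : (eq : length s ≡ length p) → (∀ i → P (lookup s i , lookup p (cast eq i))) →
                     All P (zip s p)
  All-zip-tabulate {[]}    {_}     _  _ = []
  All-zip-tabulate {_ ∷ _} {[]}    _  _ = []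
  All-zip-tabulate {_ ∷ _} {_ ∷ _} eq P = P zero ∷ All-zip-tabulate (suc-injective eq) (P ∘ suc)

orderIsomorphic⇒concordant : OrderIsomorphic s p → AllPairs Concordant (zip s p)
orderIsomorphic⇒concordant {[]}    {_}     _        = []
orderIsomorphic⇒concordant {_ ∷ _} {[]}    _        = []
orderIsomorphic⇒concordant {_ ∷ _} {_ ∷ _} (eq , f) =
  All-zip-tabulate (suc-injective eq) (f zero ∘ suc)
    ∷ orderIsomorphic⇒concordant (suc-injective eq , λ i j → f (suc i) (suc j))

concordant⇒orderIsomorphic : length s ≡ length p → AllPairs Concordant (zip s p) → OrderIsomorphic s p
concordant⇒orderIsomorphic eq C = eq , concordant-lookup eq C
  where
  concordant-lookup : (eq : length s ≡ length p) → AllPairs Concordant (zip s p) →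
    ∀ i j → Concordant (lookup s i , lookup p (cast eq i)) (lookup s j , lookup p (cast eq j))
  concordant-lookup {_ ∷ _} {_ ∷ _} _  _         zero    zero    = concordant-refl
  concordant-lookup {_ ∷ _} {_ ∷ _} eq (Cu ∷ _)  zero    (suc j) = All-zip-lookup (suc-injective eq) Cu j
  concordant-lookup {_ ∷ _} {_ ∷ _} eq (Cu ∷ _)  (suc i) zero    =
    concordant-sym (All-zip-lookup (suc-injective eq) Cu i)
  concordant-lookup {_ ∷ _} {_ ∷ _} eq (_ ∷ Cus) (suc i) (suc j) =
    concordant-lookup (suc-injective eq) Cus i j

decreasing⇒orderIsomorphic : Linked _>_ s → Linked _>_ p → length s ≡ length p → OrderIsomorphic s p
decreasing⇒orderIsomorphic Ls Lp eq = concordant⇒orderIsomorphic eq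
  (AllPairs.map (λ (b<a , y<x) → concordant-> b<a y<x)
    (Linked⇒AllPairs >-trans² (Linked-zip Ls Lp)))
  where
  >-trans² : Transitive {A = ℕ × ℕ} ((_>_ on proj₁) ∩ (_>_ on proj₂))
  >-trans² (a>b , x>y) (b>c , y>z) = <-trans b>c a>b , <-trans y>z x>y

orderIsomorphic-decreasing : OrderIsomorphic s p → Linked _>_ p → Linked _>_ s
orderIsomorphic-decreasing iso = go (proj₁ iso) (AllPairs⇒Linked (orderIsomorphic⇒concordant iso))
  where
  go : length s ≡ length p → Linked Concordant (zip s p) → Linked _>_ p → Linked _>_ s
  go {[]}             _  _       _          = []
  go {_ ∷ []}         _  _       _          = [-]
  go {_ ∷ _ ∷ _} {_ ∷ _ ∷ _} eq (C ∷ Cs) (y<x ∷ Lp) =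
    concordant⇒> C y<x ∷ go (suc-injective eq) Cs Lp

downFrom-decreasing : ∀ n → Linked _>_ (downFrom n)
downFrom-decreasing n = applyDownFrom⁺₂ id n (λ _ → ≤-refl)

orderIsomorphic-120 : c < a → a < b → OrderIsomorphic (a ∷ b ∷ c ∷ []) (1 ∷ 2 ∷ 0 ∷ [])
orderIsomorphic-120 c<a a<b = concordant⇒orderIsomorphic refl
  ( (concordant-< a<b (s<s z<s) ∷ concordant-> c<a z<s ∷ [])
  ∷ (concordant-> (<-trans c<a a<b) z<s ∷ [])
  ∷ [] ∷ [])

orderIsomorphic-201 : b < c → c < a → OrderIsomorphic (a ∷ b ∷ c ∷ []) (2 ∷ 0 ∷ 1 ∷ [])
orderIsomorphic-201 b<c c<a = concordant⇒orderIsomorphic refl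
  ( (concordant-> (<-trans b<c c<a) z<s ∷ concordant-> c<a (s<s z<s) ∷ [])
  ∷ (concordant-< b<c z<s ∷ [])
  ∷ [] ∷ [])

orderIsomorphic-1010 : b < a → OrderIsomorphic (a ∷ b ∷ a ∷ b ∷ []) (1 ∷ 0 ∷ 1 ∷ 0 ∷ [])
orderIsomorphic-1010 b<a = concordant⇒orderIsomorphic refl
  ( (concordant-> b<a z<s ∷ concordant-refl ∷ concordant-> b<a z<s ∷ [])
  ∷ (concordant-< b<a z<s ∷ concordant-refl ∷ [])
  ∷ (concordant-> b<a z<s ∷ [])
  ∷ [] ∷ [])

orderIsomorphic-downFrom : Linked _>_ s → length s ≡ suc k → OrderIsomorphic s (downFrom (suc k))
orderIsomorphic-downFrom {k = k} dec len =
  decreasing⇒orderIsomorphic dec (downFrom-decreasing (suc k)) (trans len (sym (length-downFrom (suc k))))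

PatternAvoiding : ℕ → List ℕ → Set
PatternAvoiding k w = Avoids w (1 ∷ 2 ∷ 0 ∷ []) × Avoids w (2 ∷ 0 ∷ 1 ∷ [])
                    × Avoids w (1 ∷ 0 ∷ 1 ∷ 0 ∷ []) × Avoids w (downFrom (suc k))

Avoids-⊆ : w ⊆ xs → Avoids xs p → Avoids w p
Avoids-⊆ w⊆xs avoids (s , s⊆w , iso) = avoids (s , ⊆-trans s⊆w w⊆xs , iso)

PatternAvoiding-⊆ : w ⊆ xs → PatternAvoiding k xs → PatternAvoiding k w
PatternAvoiding-⊆ w⊆xs (a₁ , a₂ , a₃ , a₄) =
  Avoids-⊆ w⊆xs a₁ , Avoids-⊆ w⊆xs a₂ , Avoids-⊆ w⊆xs a₃ , Avoids-⊆ w⊆xs a₄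

∈-stack⇒∈-out : PopRun k xs st out → y ∈ st → y ∈ out
∈-stack⇒∈-out (push _ run) y∈st = ∈-stack⇒∈-out run (there y∈st)
∈-stack⇒∈-out (pop _)      y∈st = ∈-++⁺ˡ y∈st

∈-input⇒∈-out : PopRun k xs st out → y ∈ xs → y ∈ out
∈-input⇒∈-out (push _ run)         (here refl) = ∈-stack⇒∈-out run (here refl)
∈-input⇒∈-out (push _ run)         (there y∈xs) = ∈-input⇒∈-out run y∈xs
∈-input⇒∈-out (pop {st = st} run)  y∈xs        = ∈-++⁺ʳ st (∈-input⇒∈-out run y∈xs)

∈-out⇒∈-stack⊎input : PopRun k xs st out → y ∈ out → y ∈ st ⊎ y ∈ xs
∈-out⇒∈-stack⊎input (push _ run) y∈out with ∈-out⇒∈-stack⊎input run y∈out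
... | inj₁ (here refl)  = inj₂ (here refl)
... | inj₁ (there y∈st) = inj₁ y∈st
... | inj₂ y∈xs         = inj₂ (there y∈xs)
∈-out⇒∈-stack⊎input (pop {st = st} run) y∈out with ∈-++⁻ st y∈out
... | inj₁ y∈st  = inj₁ y∈st
... | inj₂ y∈out′ with ∈-out⇒∈-stack⊎input run y∈out′
...   | inj₂ y∈xs = inj₂ y∈xs

sorted-stack : PopRun k xs st out → Linked _≤_ out → Linked _≤_ st
sorted-stack done             _      = []
sorted-stack (push _ run)     sorted = Linked.tail (sorted-stack run sorted)
sorted-stack (pop {st = st} _) sorted = Linked-resp-⊆ ≤-trans (++⁺ʳ _ ⊆-refl) sorted

popped≤remaining : PopRun k xs [] out → Linked _≤_ (st ++ out) → y ∈ st → z ∈ xs → y ≤ z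
popped≤remaining {st = st} run sorted y∈st z∈xs =
  Linked-++-across ≤-trans st sorted y∈st (∈-input⇒∈-out run z∈xs)

PopRun-⊆ : s ⊆ xs → st′ ⊆ st → PopRun k xs st out → ∃ λ out′ → PopRun k s st′ out′ × out′ ⊆ out
PopRun-⊆ [] [] done = [] , done , []
PopRun-⊆ (_ ∷ʳ s⊆xs) st′⊆st (push _ run) = PopRun-⊆ s⊆xs (_ ∷ʳ st′⊆st) run
PopRun-⊆ (refl ∷ s⊆xs) st′⊆st (push fits run) =
  let out′ , run′ , out′⊆out = PopRun-⊆ s⊆xs (refl ∷ st′⊆st) run
  in out′ , push (≤-trans (distinctCount-mono (Any-resp-⊆ (refl ∷ st′⊆st))) fits) run′ , out′⊆out
PopRun-⊆ {st′ = st′} s⊆xs st′⊆st (pop run) =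
  let out′ , run′ , out′⊆out = PopRun-⊆ s⊆xs [] run
  in st′ ++ out′ , pop run′ , ++⁺ st′⊆st out′⊆out

PopSortable-⊆ : s ⊆ w → PopSortable k w → PopSortable k s
PopSortable-⊆ s⊆w (out , run , sorted) =
  let out′ , run′ , out′⊆out = PopRun-⊆ s⊆w [] run
  in out′ , run′ , Linked-resp-⊆ ≤-trans out′⊆out sorted

run-120-unsorted : c < a → a < b → PopRun k (a ∷ b ∷ c ∷ []) [] out → ¬ Linked _≤_ out
run-120-unsorted c<a a<b (pop run) = run-120-unsorted c<a a<b run
run-120-unsorted c<a a<b (push _ (pop run)) sorted =
  <⇒≱ c<a (popped≤remaining run sorted (here refl) (there (here refl)))
run-120-unsorted c<a a<b (push _ (push _ run)) sorted = <⇒≱ a<b (Linked.head (sorted-stack run sorted))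

run-201-unsorted : b < c → c < a → PopRun k (a ∷ b ∷ c ∷ []) [] out → ¬ Linked _≤_ out
run-201-unsorted b<c c<a (pop run) = run-201-unsorted b<c c<a run
run-201-unsorted b<c c<a (push _ (pop run)) sorted =
  <⇒≱ (<-trans b<c c<a) (popped≤remaining run sorted (here refl) (here refl))
run-201-unsorted b<c c<a (push _ (push _ (pop run))) sorted =
  <⇒≱ c<a (popped≤remaining run sorted (there (here refl)) (here refl))
run-201-unsorted b<c c<a (push _ (push _ (push _ run))) sorted =
  <⇒≱ b<c (Linked.head (sorted-stack run sorted))

run-1010-unsorted : b < a → PopRun k (a ∷ b ∷ a ∷ b ∷ []) [] out → ¬ Linked _≤_ out
run-1010-unsorted b<a (pop run) = run-1010-unsorted b<a run
run-1010-unsorted b<a (push _ (pop run)) sorted =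
  <⇒≱ b<a (popped≤remaining run sorted (here refl) (here refl))
run-1010-unsorted b<a (push _ (push _ (pop run))) sorted =
  <⇒≱ b<a (popped≤remaining run sorted (there (here refl)) (there (here refl)))
run-1010-unsorted b<a (push _ (push _ (push _ run))) sorted = <⇒≱ b<a (Linked.head (sorted-stack run sorted))

decreasing-input-fills-stack : Linked _>_ (t ∷ xs) → Linked _<_ (t ∷ st) → length (t ∷ st) ≤ k →
  PopRun k xs (t ∷ st) out → Linked _≤_ out → length xs + length (t ∷ st) ≤ k
decreasing-input-fills-stack {xs = []} _ _ fits (pop _) _ = fits
decreasing-input-fills-stack {xs = _ ∷ _} (x<t ∷ _) _ _ (pop run) sorted =
  contradiction (popped≤remaining run sorted (here refl) (here refl)) (<⇒≱ x<t)
decreasing-input-fills-stack {t = t} {xs = x ∷ xs} {st} {k} (x<t ∷ dec) inc _ (push fits run) sorted =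
  subst (_≤ k) (+-suc (length xs) (length (t ∷ st)))
    (decreasing-input-fills-stack dec (x<t ∷ inc) stack-fits run sorted)
  where
  stack-fits : length (x ∷ t ∷ st) ≤ k
  stack-fits = ≤-trans (length≤distinctCount (increasing⇒unique (x<t ∷ inc))) fits

run-decreasing-unsorted : Linked _>_ s → length s ≡ suc k → PopRun k s [] out → ¬ Linked _≤_ out
run-decreasing-unsorted dec len (pop run) = run-decreasing-unsorted dec len run
run-decreasing-unsorted {s = _ ∷ xs} {k} dec len (push fits run) sorted =
  n≮n k (subst (_≤ k) (trans (+-comm (length xs) 1) len)
          (decreasing-input-fills-stack dec [-] fits run sorted))

occurrence-120-unsortable : OrderIsomorphic s (1 ∷ 2 ∷ 0 ∷ []) → ¬ PopSortable k s
occurrence-120-unsortable {s = _ ∷ _ ∷ _ ∷ []} iso (_ , run , sorted) with orderIsomorphic⇒concordant iso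
... | (C₀₁ ∷ C₀₂ ∷ []) ∷ _ =
  run-120-unsorted (concordant⇒> C₀₂ z<s) (concordant⇒< C₀₁ (s<s z<s)) run sorted

occurrence-201-unsortable : OrderIsomorphic s (2 ∷ 0 ∷ 1 ∷ []) → ¬ PopSortable k s
occurrence-201-unsortable {s = _ ∷ _ ∷ _ ∷ []} iso (_ , run , sorted) with orderIsomorphic⇒concordant iso
... | (_ ∷ C₀₂ ∷ []) ∷ (C₁₂ ∷ []) ∷ _ =
  run-201-unsorted (concordant⇒< C₁₂ z<s) (concordant⇒> C₀₂ (s<s z<s)) run sorted

occurrence-1010-unsortable : OrderIsomorphic s (1 ∷ 0 ∷ 1 ∷ 0 ∷ []) → ¬ PopSortable k s
occurrence-1010-unsortable {s = _ ∷ _ ∷ _ ∷ _ ∷ []} iso (_ , run , sorted) with orderIsomorphic⇒concordant iso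
... | (C₀₁ ∷ C₀₂ ∷ _ ∷ []) ∷ (_ ∷ C₁₃ ∷ []) ∷ _
  with concordant⇒≡ C₀₂ refl | concordant⇒≡ C₁₃ refl
...   | refl | refl = run-1010-unsorted (concordant⇒> C₀₁ z<s) run sorted

occurrence-downFrom-unsortable : OrderIsomorphic s (downFrom (suc k)) → ¬ PopSortable k s
occurrence-downFrom-unsortable {k = k} iso (_ , run , sorted) =
  run-decreasing-unsorted (orderIsomorphic-decreasing iso (downFrom-decreasing (suc k)))
    (trans (proj₁ iso) (length-downFrom (suc k))) run sorted

sortable⇒avoids : (∀ {s} → OrderIsomorphic s p → ¬ PopSortable k s) → PopSortable k w → Avoids w p
sortable⇒avoids unsortable sortable (s , s⊆w , iso) = unsortable iso (PopSortable-⊆ s⊆w sortable)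

popSortable⇒patternAvoiding : PopSortable k w → PatternAvoiding k w
popSortable⇒patternAvoiding sortable =
    sortable⇒avoids occurrence-120-unsortable sortable
  , sortable⇒avoids occurrence-201-unsortable sortable
  , sortable⇒avoids occurrence-1010-unsortable sortable
  , sortable⇒avoids occurrence-downFrom-unsortable sortable

-- Roles in the next three lemmas: t is the top of the stack, y an entry below it, x the next unread
-- entry and z a later one; t < x is when the greedy strategy pops.
top≤later : PatternAvoiding k (t ∷ x ∷ z ∷ []) → t < x → t ≤ z
top≤later (avoids-120 , _) t<x = ≮⇒≥ λ z<t → avoids-120 (_ , ⊆-refl , orderIsomorphic-120 z<t t<x)

below≤next : PatternAvoiding k (y ∷ t ∷ x ∷ []) → t < x → y ≤ x
below≤next (_ , avoids-201 , _) t<x = ≮⇒≥ λ x<y → avoids-201 (_ , ⊆-refl , orderIsomorphic-201 t<x x<y)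

below≤later : PatternAvoiding k (y ∷ t ∷ x ∷ z ∷ []) → t ≤ y → t < x → y ≤ z
below≤later pa@(avoids-120 , avoids-201 , avoids-1010 , _) t≤y t<x
  with m≤n⇒m<n∨m≡n (below≤next (PatternAvoiding-⊆ (refl ∷ refl ∷ refl ∷ _ ∷ʳ []) pa) t<x)
     | m≤n⇒m<n∨m≡n (top≤later (PatternAvoiding-⊆ (_ ∷ʳ refl ∷ refl ∷ refl ∷ []) pa) t<x)
... | inj₁ y<x  | _         = ≮⇒≥ λ z<y →
  avoids-120 (_ , refl ∷ _ ∷ʳ refl ∷ refl ∷ [] , orderIsomorphic-120 z<y y<x)
... | inj₂ refl | inj₁ t<z  = ≮⇒≥ λ z<y →
  avoids-201 (_ , refl ∷ refl ∷ _ ∷ʳ refl ∷ [] , orderIsomorphic-201 t<z z<y)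
... | inj₂ refl | inj₂ refl = ≮⇒≥ λ z<y →
  avoids-1010 (_ , ⊆-refl , orderIsomorphic-1010 z<y)

stack≤input : PatternAvoiding k ((t ∷ st) ʳ++ (x ∷ xs)) → Linked _≤_ (t ∷ st) → t < x →
  y ∈ t ∷ st → z ∈ x ∷ xs → y ≤ z
stack≤input _ _ t<x (here refl) (here refl) = <⇒≤ t<x
stack≤input {st = st} pa _ t<x (here refl) (there z∈xs) =
  top≤later (PatternAvoiding-⊆ (ʳ++⁺ (minimum st) (refl ∷ refl ∷ from∈ z∈xs)) pa) t<x
stack≤input {xs = xs} pa _ t<x (there y∈st) (here refl) =
  below≤next (PatternAvoiding-⊆ (ʳ++⁺ (from∈ y∈st) (refl ∷ refl ∷ minimum xs)) pa) t<x
stack≤input pa sorted t<x (there y∈st) (there z∈xs) =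
  below≤later (PatternAvoiding-⊆ (ʳ++⁺ (from∈ y∈st) (refl ∷ refl ∷ from∈ z∈xs)) pa)
    (All.lookup (AllPairs.head (Linked⇒AllPairs ≤-trans sorted)) y∈st) t<x

increasing-cover : Linked _≤_ (x ∷ xs) →
  ∃ λ ys → x ∷ ys ⊆ x ∷ xs × Linked _<_ (x ∷ ys) × (∀ {y} → y ∈ x ∷ xs → y ∈ x ∷ ys)
increasing-cover [-] = [] , ⊆-refl , [-] , id
increasing-cover {x} (x≤y ∷ sorted) with increasing-cover sorted | m≤n⇒m<n∨m≡n x≤y
... | ys , ys⊆xs , inc , cover | inj₂ refl =
  ys , x ∷ʳ ys⊆xs , inc , λ { (here refl) → here refl ; (there y∈xs) → cover y∈xs }
... | ys , ys⊆xs , inc , cover | inj₁ x<y =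
  _ ∷ ys , refl ∷ ys⊆xs , x<y ∷ inc , λ { (here refl) → here refl ; (there y∈xs) → there (cover y∈xs) }

overflow⇒increasing : Linked _≤_ st → k < distinctCount st → ∃ λ s → s ⊆ st × Linked _<_ s × length s ≡ suc k
overflow⇒increasing {x ∷ st} {k} sorted k<dc with increasing-cover sorted
... | ys , ys⊆st , inc , cover =
  take (suc k) (x ∷ ys) , ⊆-trans (take-⊆ (suc k) (x ∷ ys)) ys⊆st
  , Linked-resp-⊆ <-trans (take-⊆ (suc k) (x ∷ ys)) inc
  , trans (length-take (suc k) (x ∷ ys)) (m≤n⇒m⊓n≡m long)
  where
  long : suc k ≤ length (x ∷ ys)
  long = ≤-trans k<dc (≤-trans (distinctCount-mono cover) (distinctCount≤length (x ∷ ys)))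

stack-within-depth : PatternAvoiding k ((x ∷ st) ʳ++ xs) → Linked _≤_ (x ∷ st) → distinctCount (x ∷ st) ≤ k
stack-within-depth {xs = xs} (_ , _ , _ , avoids-downFrom) sorted = ≮⇒≥ λ k<dc →
  let s , s⊆st , inc , len = overflow⇒increasing sorted k<dc
  in avoids-downFrom (reverse s , ʳ++⁺ s⊆st (minimum xs)
                     , orderIsomorphic-downFrom (Linked-reverse inc) (trans (length-reverse s) len))

-- st ʳ++ xs is the stack read bottom-up followed by the unread input: a subsequence of the word
-- being sorted, so it inherits pattern avoidance.
sort-greedily : PatternAvoiding k (st ʳ++ xs) → Linked _≤_ st → ∃ λ out → PopRun k xs st out × Linked _≤_ out
push-greedily : PatternAvoiding k ((x ∷ st) ʳ++ xs) → Linked _≤_ (x ∷ st) →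
                ∃ λ out → PopRun k (x ∷ xs) st out × Linked _≤_ out

sort-greedily {st = st} {xs = []} _ sorted = st ++ [] , pop done , Linked-++ ≤-trans sorted [] (λ _ ())
sort-greedily {st = []} {xs = _ ∷ _} pa _ = push-greedily pa [-]
sort-greedily {st = t ∷ st} {xs = x ∷ xs} pa sorted with x ≤? t
... | yes x≤t = push-greedily pa (x≤t ∷ sorted)
... | no x≰t =
  let out , run , sorted′ = push-greedily (PatternAvoiding-⊆ (ʳ++⁺ (minimum (t ∷ st)) ⊆-refl) pa) [-]
  in (t ∷ st) ++ out , pop run
   , Linked-++ ≤-trans sorted sorted′ λ y∈st z∈out →
       stack≤input pa sorted (≰⇒> x≰t) y∈st ([ (λ ()) , id ]′ (∈-out⇒∈-stack⊎input run z∈out))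

push-greedily pa sorted =
  let out , run , sorted′ = sort-greedily pa sorted
  in out , push (stack-within-depth pa sorted) run , sorted′

mainTheorem10 : (k : ℕ) → 1 ≤ k → (e : List ℕ) → IsInversionSequence e →
    PopSortable k e ⇔
      (Avoids e (1 ∷ 2 ∷ 0 ∷ []) × Avoids e (2 ∷ 0 ∷ 1 ∷ [])
       × Avoids e (1 ∷ 0 ∷ 1 ∷ 0 ∷ []) × Avoids e (downFrom (suc k)))
mainTheorem10 k _ e _ = mk⇔ popSortable⇒patternAvoiding (λ pa → sort-greedily pa [])
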